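{- Let $\mathbf{A}$ be a countable enumerated $\mathcal{L}$-structure all of whose finite substructures belong to $\mathcal{K}$. Let $m<\omega$ with $m\le|\mathbf{A}|$ and let $g\in\mathrm{OL}(\mathbf{A}_m,\mathbf{K})$. Then there is $f\in\mathrm{OL}(\mathbf{A},\mathbf{K})$ extending $g$; moreover, if $m<|\mathbf{A}|$, then for any $N<\omega$ such an $f$ can be chosen with $f(m)\ge N$.
   Context: Fix a finite relational language $\mathcal{L}=\{U_i:i<k^{\mathsf{u}}\}\cup\{R_i:i<k\}$ with $U_i$ unary and $R_i$ binary. All $\mathcal{L}$-structures $\mathbf{A}$ satisfy: each vertex $a$ satisfies exactly one $U_i$ (write $U^{\mathbf{A}}(a)=i$); $R_i^{\mathbf{A}}(a,a)$ never holds; any distinct $a,b$ satisfy exactly one $R_i(a,b)$ (write $R^{\mathbf{A}}(a,b)=i$); there is an involution $\mathrm{Flip}$ of $k$ with $\mathrm{Flip}(0)=0$ and $R_i(a,b)\iff R_{\mathrm{Flip}(i)}(b,a)$. The value $R=0$ means "no relation". A structure is irreducible if $R(a,b)\neq 0$ for all distinct $a,b$. $\mathcal{F}$ is a finite set of finite irreducible $\mathcal{L}$-structures and $\mathcal{K}=\mathrm{Forb}(\mathcal{F})$ is the class of finite $\mathcal{L}$-structures into which no member of $\mathcal{F}$ embeds. An enumerated structure has underlying set the cardinal $|\mathbf{A}|$; $\mathbf{A}_m$ is the induced substructure on $\{0,\dots,m-1\}$. Ordered embeddings are order-preserving embeddings; $\mathrm{OEmb}(\mathbf{A},\mathbf{B})$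 denotes them. $\mathbf{K}$ is a fixed enumerated Fra\"iss\'e limit of $\mathcal{K}$ which is left dense: for every enumerated $\mathbf{B}\in\mathcal{K}$ with $|\mathbf{B}|=m+1$ and $\mathbf{B}_m=\mathbf{K}_m$ there is $f\in\mathrm{OEmb}(\mathbf{B},\mathbf{K})$ which is the identity on $\{0,\dots,m-1\}$ and satisfies $R^{\mathbf{K}}(f(m),r)=0$ for all $r$ with $m\le r<f(m)$. A subset $\mathbf{B}\subseteq\mathbf{K}$ is left-leaning if whenever $a\in\mathbf{B}$, $x<a$ and $R^{\mathbf{K}}(a,x)\ne0$, then $x\in\mathbf{B}$. $\mathrm{OL}(\mathbf{A},\mathbf{K})$ is the set of $f\in\mathrm{OEmb}(\mathbf{A},\mathbf{K})$ whose image is left-leaning. -}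

module Defs where

open import Data.Nat using (ℕ; zero; suc; _≤_; _<_)
open import Data.Fin using (Fin) renaming (zero to fzero)
open import Data.Unit using (⊤)
open import Data.Empty using (⊥)
open import Data.Product using (Σ; ∃; ∃-syntax; _×_; _,_)
open import Data.List using (List)
open import Data.List.Membership.Propositional using (_∈_)
open import Relation.Nullary using (¬_)
open import Relation.Binary.PropositionalEquality using (_≡_; _≢_)

-- The language L = {U_i : i < ku} ∪ {R_i : i < k}.
-- Binary relation symbols are indexed by Fin k with k ≥ 1 (R_0 = "no relation"),
-- so we store k as suc k-1.

record Lang : Set where
  field
    ku   : ℕ
    k-1  : ℕ
    Flip       : Fin (suc k-1) → Fin (suc k-1)
    Flip-invol : ∀ i → Flip (Flip i) ≡ i
    Flip-zero  : Flip fzero ≡ fzero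

open Lang public

Rel : Lang → Set
Rel L = Fin (suc (k-1 L))

data Card : Set where
  fin : ℕ → Card
  ω   : Card

_∈ᶜ_ : ℕ → Card → Set
i ∈ᶜ fin n = i < n
i ∈ᶜ ω     = ⊤

_≤ᶜ_ : ℕ → Card → Set
m ≤ᶜ fin n = m ≤ n
m ≤ᶜ ω     = ⊤

-- U and R are given as total functions on ℕ; only their values on the
-- domain {i | i ∈ᶜ c} (and, for R, on distinct pairs) are meaningful.
-- U(a) = i means a satisfies exactly U_i; R(a,b) = i means exactly R_i(a,b)
-- (for distinct a, b; R_i(a,a) never holds, so R on the diagonal is ignored).

record Str (L : Lang) (c : Card) : Set where
  field
    U : ℕ → Fin (ku L)
    R : ℕ → ℕ → Rel L

open Str public

IsStr : ∀ {L c} → Str L c → Set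
IsStr {L} {c} A = ∀ a b → a ∈ᶜ c → b ∈ᶜ c → a ≢ b → R A b a ≡ Flip L (R A a b)

Irreducible : ∀ {L c} → Str L c → Set
Irreducible {L} {c} A = ∀ a b → a ∈ᶜ c → b ∈ᶜ c → a ≢ b → R A a b ≢ fzero

-- A_m : induced substructure on {0,…,m-1} (meaningful when m ≤ |A|).
_↾_ : ∀ {L c} → Str L c → (m : ℕ) → Str L (fin m)
A ↾ m = record { U = U A ; R = R A }

-- Embeddings and ordered embeddings f : A → B (f given as a map ℕ → ℕ,
-- only its values on the domain of A matter).

record IsEmb {L c d} (A : Str L c) (B : Str L d) (f : ℕ → ℕ) : Set where
  field
    into  : ∀ i → i ∈ᶜ c → f i ∈ᶜ d
    inj   : ∀ i j → i ∈ᶜ c → j ∈ᶜ c → f i ≡ f j → i ≡ j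
    presU : ∀ i → i ∈ᶜ c → U B (f i) ≡ U A i
    presR : ∀ i j → i ∈ᶜ c → j ∈ᶜ c → i ≢ j → R B (f i) (f j) ≡ R A i j

record IsOEmb {L c d} (A : Str L c) (B : Str L d) (f : ℕ → ℕ) : Set where
  field
    into  : ∀ i → i ∈ᶜ c → f i ∈ᶜ d
    mono  : ∀ i j → i ∈ᶜ c → j ∈ᶜ c → i < j → f i < f j
    presU : ∀ i → i ∈ᶜ c → U B (f i) ≡ U A i
    presR : ∀ i j → i ∈ᶜ c → j ∈ᶜ c → i ≢ j → R B (f i) (f j) ≡ R A i j

FinStr : Lang → Set
FinStr L = Σ ℕ λ n → Str L (fin n)

ValidForb : ∀ {L} → List (FinStr L) → Set
ValidForb {L} 𝓕 = ∀ {n} {F : Str L (fin n)} → (n , F) ∈ 𝓕 → IsStr F × Irreducible F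

InForb : ∀ {L c} → List (FinStr L) → Str L c → Set
InForb {L} 𝓕 B = ∀ {n} {F : Str L (fin n)} → (n , F) ∈ 𝓕 → ∀ f → ¬ IsEmb F B f

-- Finite substructures of A: given by an injective map e from {0,…,n-1}
-- into the domain of A; the substructure is (isomorphic to) the pullback.

IsFinSub : ∀ {L c} → Str L c → (n : ℕ) → (ℕ → ℕ) → Set
IsFinSub {L} {c} A n e =
  (∀ i → i < n → e i ∈ᶜ c) × (∀ i j → i < n → j < n → e i ≡ e j → i ≡ j)

pull : ∀ {L c} → Str L c → (n : ℕ) → (ℕ → ℕ) → Str L (fin n)
pull A n e = record { U = λ i → U A (e i) ; R = λ i j → R A (e i) (e j) }

FinSubsInForb : ∀ {L c} → List (FinStr L) → Str L c → Set
FinSubsInForb 𝓕 A = ∀ n e → IsFinSub A n e → InForb 𝓕 (pull A n e)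

-- K is an enumerated Fraïssé limit of 𝒦 = Forb(𝓕): its age is 𝒦
-- and it has the extension property (for countable structures this is
-- equivalent to ultrahomogeneity with age 𝒦).

record IsFraisseLimit {L κ} (𝓕 : List (FinStr L)) (K : Str L κ) : Set where
  field
    isStr   : IsStr K
    age⊆    : FinSubsInForb 𝓕 K
    ⊆age    : ∀ n (B : Str L (fin n)) → IsStr B → InForb 𝓕 B →
              ∃[ f ] IsEmb B K f
    extend  : ∀ n m (B : Str L (fin n)) → IsStr B → InForb 𝓕 B → m ≤ n →
              ∀ f → IsEmb (B ↾ m) K f →
              ∃[ g ] (IsEmb B K g × (∀ i → i < m → g i ≡ f i))

SameInitial : ∀ {L c d} → ℕ → Str L c → Str L d → Set
SameInitial m B K =
  (∀ i → i < m → U B i ≡ U K i) ×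
  (∀ i j → i < m → j < m → i ≢ j → R B i j ≡ R K i j)

LeftDense : ∀ {L κ} → List (FinStr L) → Str L κ → Set
LeftDense {L} {κ} 𝓕 K =
  ∀ m (B : Str L (fin (suc m))) → IsStr B → InForb 𝓕 B →
  m ≤ᶜ κ → SameInitial m B K →
  ∃[ f ] (IsOEmb B K f × (∀ i → i < m → f i ≡ i) ×
          (∀ r → m ≤ r → r < f m → R K (f m) r ≡ fzero))

LeftLeaning : ∀ {L κ} → Str L κ → (ℕ → Set) → Set
LeftLeaning K P = ∀ a x → P a → x < a → R K a x ≢ fzero → P x

Image : ∀ {L c} → Str L c → (ℕ → ℕ) → ℕ → Set
Image {L} {c} A f y = ∃[ i ] (i ∈ᶜ c × f i ≡ y)

IsOL : ∀ {L c κ} → Str L c → Str L κ → (ℕ → ℕ) → Set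
IsOL A K f = IsOEmb A K f × LeftLeaning K (Image A f)

-- Extend g one point at a time. Given an OL-embedding h of A_p with image below n, glue to
-- K_n a new vertex n carrying the type of p over the image of h and no relation to the rest
-- of K_n. This structure lies in 𝒦: a copy of an irreducible member of 𝓕 either misses the
-- new vertex, and so lies in K_n, or is entirely related to it, and so lies in a copy of
-- A_{p+1}. Left density embeds it into K fixing K_n and sending n to some f(n) ≥ n unrelated
-- to everything in [n, f(n)); hence h ∪ {p ↦ f(n)} is again left-leaning. Choosing n ≥ N
-- gives f(m) ≥ N, and the union of the resulting chain is the required f.
module Submission where

open import Defs
open import Data.Nat using (ℕ; zero; suc; _≤_; _<_; _+_; _⊔_; _⊓_; z≤n; s≤s)
open import Data.Nat.Properties
open import Data.Fin using (Fin) renaming (zero to fzero)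
open import Data.Unit using (tt)
open import Data.Empty using (⊥)
open import Data.Sum using (inj₁; inj₂)
open import Data.Product using (Σ; ∃-syntax; _×_; _,_; proj₁; proj₂; uncurry; map₂)
open import Data.List using (List)
open import Data.List.Membership.Propositional using (_∈_)
open import Function using (_∘_; id; case_of_)
open import Relation.Nullary using (¬_; Dec; yes; no; contradiction)
open import Relation.Binary.PropositionalEquality
open import Relation.Binary.Definitions using (tri<; tri≈; tri>)
open ≡-Reasoning

<-≤ᶜ-trans : ∀ {i m} c → i < m → m ≤ᶜ c → i ∈ᶜ c
<-≤ᶜ-trans (fin n) = <-≤-trans
<-≤ᶜ-trans ω _ _ = tt

≤-∈ᶜ-trans : ∀ {i p} c → i ≤ p → p ∈ᶜ c → i ∈ᶜ c
≤-∈ᶜ-trans (fin n) = ≤-<-trans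
≤-∈ᶜ-trans ω _ _ = tt

∈ᶜ⇒≤ᶜ : ∀ {q} c → q ∈ᶜ c → q ≤ᶜ c
∈ᶜ⇒≤ᶜ (fin n) = <⇒≤
∈ᶜ⇒≤ᶜ ω _ = tt

∈ᶜ⇒suc≤ᶜ : ∀ {q} c → q ∈ᶜ c → suc q ≤ᶜ c
∈ᶜ⇒suc≤ᶜ (fin n) q<n = q<n
∈ᶜ⇒suc≤ᶜ ω _ = tt

_∈ᶜ?_ : ∀ i c → Dec (i ∈ᶜ c)
i ∈ᶜ? fin n = i <? n
i ∈ᶜ? ω = yes tt

_⊓ᶜ_ : ℕ → Card → ℕ
q ⊓ᶜ fin n = q ⊓ n
q ⊓ᶜ ω = q

<-⊓ᶜ : ∀ {i q} c → i < q → i ∈ᶜ c → i < q ⊓ᶜ c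
<-⊓ᶜ (fin n) = ⊓-pres-m<
<-⊓ᶜ ω i<q _ = i<q

<⊓ᶜ⇒< : ∀ {i} q c → i < q ⊓ᶜ c → i < q
<⊓ᶜ⇒< q (fin n) = m<n⊓o⇒m<n q n
<⊓ᶜ⇒< q ω i<q = i<q

<⊓ᶜ⇒∈ᶜ : ∀ {i} q c → i < q ⊓ᶜ c → i ∈ᶜ c
<⊓ᶜ⇒∈ᶜ q (fin n) = m<n⊓o⇒m<o q n
<⊓ᶜ⇒∈ᶜ q ω _ = tt

≤ᶜ⇒⊓ᶜ≡ : ∀ {q} c → q ≤ᶜ c → q ⊓ᶜ c ≡ q
≤ᶜ⇒⊓ᶜ≡ (fin n) = m≤n⇒m⊓n≡m
≤ᶜ⇒⊓ᶜ≡ ω _ = refl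

∉ᶜ⇒suc-⊓ᶜ≡ : ∀ {q} c → ¬ q ∈ᶜ c → suc q ⊓ᶜ c ≡ q ⊓ᶜ c
∉ᶜ⇒suc-⊓ᶜ≡ {q} (fin n) q∉n = begin
  suc q ⊓ n ≡⟨ m≥n⇒m⊓n≡n (m≤n⇒m≤1+n n≤q) ⟩
  n         ≡⟨ sym (m≥n⇒m⊓n≡n n≤q) ⟩
  q ⊓ n     ∎
  where
  n≤q : n ≤ q
  n≤q = ≮⇒≥ q∉n
∉ᶜ⇒suc-⊓ᶜ≡ ω q∉ω = contradiction tt q∉ω

upperBound : (h : ℕ → ℕ) (p : ℕ) → ∃[ b ] (∀ t → t < p → h t < b)
upperBound h zero = 0 , λ _ ()
upperBound h (suc p) with upperBound h p
... | b , h<b = b ⊔ suc (h p) , below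
  where
  below : ∀ t → t < suc p → h t < b ⊔ suc (h p)
  below t t<1+p with m<1+n⇒m<n∨m≡n t<1+p
  ... | inj₁ t<p = <-≤-trans (h<b t t<p) (m≤m⊔n b (suc (h p)))
  ... | inj₂ refl = m≤n⊔m b (suc (h p))

identityBelow⇒≤ : (f : ℕ → ℕ) (k : ℕ) → (∀ i → i < k → f i ≡ i) →
                  (∀ i → i < k → f i < f k) → k ≤ f k
identityBelow⇒≤ f zero _ _ = z≤n
identityBelow⇒≤ f (suc k) f-id f-mono = subst (_< f (suc k)) (f-id k ≤-refl) (f-mono k ≤-refl)

extendAt : (ℕ → ℕ) → ℕ → ℕ → ℕ → ℕ
extendAt h p y t with t <? p
... | yes _ = h t
... | no _ = y

extendAt-< : ∀ h {p} y {t} → t < p → extendAt h p y t ≡ h t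
extendAt-< h {p} y {t} t<p with t <? p
... | yes _ = refl
... | no t≮p = contradiction t<p t≮p

extendAt-≡ : ∀ h p y → extendAt h p y p ≡ y
extendAt-≡ h p y with p <? p
... | yes p<p = contradiction p<p (n≮n p)
... | no _ = refl

module Stabilising (m : ℕ) (H : ℕ → ℕ → ℕ)
                   (H-stable : ∀ s i → i < s + m → H (suc s) i ≡ H s i) where

  stable : ∀ {s s'} i → s ≤ s' → i < s + m → H s' i ≡ H s i
  stable {s} {zero} i z≤n _ = refl
  stable {s} {suc s'} i s≤1+s' i<s+m with m≤n⇒m<n∨m≡n s≤1+s'
  ... | inj₂ refl = refl
  ... | inj₁ s<1+s' = trans (H-stable s' i (<-≤-trans i<s+m (+-monoˡ-≤ m s≤s')))
                            (stable i s≤s' i<s+m)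
    where
    s≤s' : s ≤ s'
    s≤s' = m<1+n⇒m≤n s<1+s'

  limit : ℕ → ℕ
  limit t = H (suc t) t

  limit-agrees : ∀ {t s} → t < s + m → limit t ≡ H s t
  limit-agrees {t} {s} t<s+m with ≤-total (suc t) s
  ... | inj₁ 1+t≤s = sym (stable t 1+t≤s (m≤m+n (suc t) m))
  ... | inj₂ s≤1+t = stable t s≤1+t t<s+m

module _ {L : Lang} where

  IsOEmb⇒IsEmb : ∀ {c d} {A : Str L c} {B : Str L d} {f} → IsOEmb A B f → IsEmb A B f
  IsOEmb⇒IsEmb {c} {f = f} F = record
    { into = IsOEmb.into F ; inj = inj ; presU = IsOEmb.presU F ; presR = IsOEmb.presR F }
    where
    inj : ∀ i j → i ∈ᶜ c → j ∈ᶜ c → f i ≡ f j → i ≡ j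
    inj i j i∈ j∈ fi≡fj with <-cmp i j
    ... | tri< i<j _ _ = contradiction fi≡fj (<⇒≢ (IsOEmb.mono F i j i∈ j∈ i<j))
    ... | tri≈ _ i≡j _ = i≡j
    ... | tri> _ _ j<i = contradiction (sym fi≡fj) (<⇒≢ (IsOEmb.mono F j i j∈ i∈ j<i))

  IsOEmb-∘ : ∀ {c d e} {A : Str L c} {B : Str L d} {C : Str L e} {f g} →
             IsOEmb B C g → IsOEmb A B f → IsOEmb A C (g ∘ f)
  IsOEmb-∘ {c} {d} {f = f} G F = record
    { into = λ i i∈ → IsOEmb.into G (f i) (f-into i i∈)
    ; mono = λ i j i∈ j∈ i<j → IsOEmb.mono G (f i) (f j) (f-into i i∈) (f-into j j∈)
                                  (IsOEmb.mono F i j i∈ j∈ i<j)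
    ; presU = λ i i∈ → trans (IsOEmb.presU G (f i) (f-into i i∈)) (IsOEmb.presU F i i∈)
    ; presR = λ i j i∈ j∈ i≢j →
        trans (IsOEmb.presR G (f i) (f j) (f-into i i∈) (f-into j j∈)
                (i≢j ∘ IsEmb.inj (IsOEmb⇒IsEmb F) i j i∈ j∈))
              (IsOEmb.presR F i j i∈ j∈ i≢j)
    }
    where
    f-into : ∀ i → i ∈ᶜ c → f i ∈ᶜ d
    f-into = IsOEmb.into F

  factorThrough : ∀ {c d n} {C : Str L c} {B : Str L d} {F : Str L (fin n)} {θ e} →
                  IsEmb C B θ → IsEmb F B e →
                  (∀ i → i < n → ∃[ t ] (t ∈ᶜ c × θ t ≡ e i)) → ∃[ φ ] IsEmb F C φ
  factorThrough {c} {n = n} {C} {B} {F} {θ} {e} Θ E cover =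
    φ , record { into = λ i i<n → proj₁ (φ-spec i i<n) ; inj = inj ; presU = presU ; presR = presR }
    where
    φ : ℕ → ℕ
    φ i with i <? n
    ... | yes i<n = proj₁ (cover i i<n)
    ... | no _ = 0

    φ-spec : ∀ i → i < n → φ i ∈ᶜ c × θ (φ i) ≡ e i
    φ-spec i i<n with i <? n
    ... | yes i<n′ = proj₂ (cover i i<n′)
    ... | no i≮n = contradiction i<n i≮n

    θφ : ∀ {i} → i < n → θ (φ i) ≡ e i
    θφ {i} i<n = proj₂ (φ-spec i i<n)

    inj : ∀ i j → i < n → j < n → φ i ≡ φ j → i ≡ j
    inj i j i<n j<n φi≡φj =
      IsEmb.inj E i j i<n j<n (trans (sym (θφ i<n)) (trans (cong θ φi≡φj) (θφ j<n)))

    presU : ∀ i → i < n → U C (φ i) ≡ U F i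
    presU i i<n = begin
      U C (φ i)     ≡⟨ sym (IsEmb.presU Θ (φ i) (proj₁ (φ-spec i i<n))) ⟩
      U B (θ (φ i)) ≡⟨ cong (U B) (θφ i<n) ⟩
      U B (e i)     ≡⟨ IsEmb.presU E i i<n ⟩
      U F i         ∎

    presR : ∀ i j → i < n → j < n → i ≢ j → R C (φ i) (φ j) ≡ R F i j
    presR i j i<n j<n i≢j = begin
      R C (φ i) (φ j)           ≡⟨ sym (IsEmb.presR Θ (φ i) (φ j) (proj₁ (φ-spec i i<n))
                                     (proj₁ (φ-spec j j<n)) (i≢j ∘ inj i j i<n j<n)) ⟩
      R B (θ (φ i)) (θ (φ j))   ≡⟨ cong₂ (R B) (θφ i<n) (θφ j<n) ⟩
      R B (e i) (e j)           ≡⟨ IsEmb.presR E i j i<n j<n i≢j ⟩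
      R F i j                   ∎

  ↾-InForb : ∀ {c} {𝓕 : List (FinStr L)} {A : Str L c} → FinSubsInForb 𝓕 A →
             ∀ {n} → n ≤ᶜ c → InForb 𝓕 (A ↾ n)
  ↾-InForb {c} forb {n} n≤c = forb n id ((λ i i<n → <-≤ᶜ-trans c i<n n≤c) , λ _ _ _ _ i≡j → i≡j)

  SameInitial⇒idEmb : ∀ {κ d n} {K : Str L κ} {B : Str L d} →
                      n ≤ᶜ d → SameInitial n B K → IsEmb (K ↾ n) B id
  SameInitial⇒idEmb {d = d} n≤d (sameU , sameR) = record
    { into = λ i i<n → <-≤ᶜ-trans d i<n n≤d
    ; inj = λ _ _ _ _ i≡j → i≡j
    ; presU = sameU
    ; presR = sameR
    }

  module AddVertex {κ} (K : Str L κ) (n : ℕ) (u : Fin (ku L)) (ρ : ℕ → Rel L) where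

    U⁺ : ℕ → Fin (ku L)
    U⁺ j with j <? n
    ... | yes _ = U K j
    ... | no _ = u

    R⁺ : ℕ → ℕ → Rel L
    R⁺ i j with i <? n | j <? n
    ... | yes _ | yes _ = R K i j
    ... | no _  | yes _ = ρ j
    ... | yes _ | no _  = Flip L (ρ i)
    ... | no _  | no _  = fzero

    K⁺ : Str L (fin (suc n))
    K⁺ = record { U = U⁺ ; R = R⁺ }

    U⁺-old : ∀ j → j < n → U⁺ j ≡ U K j
    U⁺-old j j<n with j <? n
    ... | yes _ = refl
    ... | no j≮n = contradiction j<n j≮n

    U⁺-new : U⁺ n ≡ u
    U⁺-new with n <? n
    ... | yes n<n = contradiction n<n (n≮n n)
    ... | no _ = refl

    R⁺-old : ∀ i j → i < n → j < n → R⁺ i j ≡ R K i j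
    R⁺-old i j i<n j<n with i <? n | j <? n
    ... | yes _ | yes _ = refl
    ... | no i≮n | _ = contradiction i<n i≮n
    ... | yes _ | no j≮n = contradiction j<n j≮n

    R⁺-from-new : ∀ j → j < n → R⁺ n j ≡ ρ j
    R⁺-from-new j j<n with n <? n | j <? n
    ... | yes n<n | _ = contradiction n<n (n≮n n)
    ... | no _ | yes _ = refl
    ... | no _ | no j≮n = contradiction j<n j≮n

    R⁺-to-new : ∀ i → i < n → R⁺ i n ≡ Flip L (ρ i)
    R⁺-to-new i i<n with i <? n | n <? n
    ... | _ | yes n<n = contradiction n<n (n≮n n)
    ... | yes _ | no _ = refl
    ... | no i≮n | no _ = contradiction i<n i≮n

    isStr : n ≤ᶜ κ → IsStr K → IsStr K⁺
    isStr n≤κ K-isStr a b a≤n b≤n a≢b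
      with m<1+n⇒m<n∨m≡n a≤n | m<1+n⇒m<n∨m≡n b≤n
    ... | inj₁ a<n | inj₁ b<n = begin
      R⁺ b a              ≡⟨ R⁺-old b a b<n a<n ⟩
      R K b a             ≡⟨ K-isStr a b (<-≤ᶜ-trans κ a<n n≤κ) (<-≤ᶜ-trans κ b<n n≤κ) a≢b ⟩
      Flip L (R K a b)    ≡⟨ cong (Flip L) (sym (R⁺-old a b a<n b<n)) ⟩
      Flip L (R⁺ a b)     ∎
    ... | inj₁ a<n | inj₂ refl = begin
      R⁺ n a              ≡⟨ R⁺-from-new a a<n ⟩
      ρ a                 ≡⟨ sym (Flip-invol L (ρ a)) ⟩
      Flip L (Flip L (ρ a)) ≡⟨ cong (Flip L) (sym (R⁺-to-new a a<n)) ⟩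
      Flip L (R⁺ a n)     ∎
    ... | inj₂ refl | inj₁ b<n = trans (R⁺-to-new b b<n) (cong (Flip L) (sym (R⁺-from-new b b<n)))
    ... | inj₂ refl | inj₂ refl = contradiction refl a≢b

    sameInitial : SameInitial n K⁺ K
    sameInitial = U⁺-old , λ i j i<n j<n _ → R⁺-old i j i<n j<n

  module TypeOverImage {c} (A : Str L c) (p : ℕ) (h : ℕ → ℕ) where

    ρ : ℕ → Rel L
    ρ y with anyUpTo? (λ t → h t ≟ y) p
    ... | yes (t , _ , _) = R A p t
    ... | no _ = fzero

    ρ-image : (∀ t t′ → t < p → t′ < p → h t ≡ h t′ → t ≡ t′) →
              ∀ {t} → t < p → ρ (h t) ≡ R A p t
    ρ-image h-inj {t} t<p with anyUpTo? (λ t′ → h t′ ≟ h t) p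
    ... | yes (t′ , t′<p , ht′≡ht) = cong (R A p) (h-inj t′ t t′<p t<p ht′≡ht)
    ... | no none = contradiction (t , t<p , refl) none

    ρ≢0⇒image : ∀ y → ρ y ≢ fzero → ∃[ t ] (t < p × h t ≡ y)
    ρ≢0⇒image y ρy≢0 with anyUpTo? (λ t → h t ≟ y) p
    ... | yes found = found
    ... | no _ = contradiction refl ρy≢0

module OneStep {L : Lang} {𝓕 : List (FinStr L)} (valid : ValidForb 𝓕)
  {κ} (K : Str L κ) (K-limit : IsFraisseLimit 𝓕 K) (K-leftDense : LeftDense 𝓕 K)
  {c} (A : Str L c) (A-isStr : IsStr A) (A-forb : FinSubsInForb 𝓕 A)
  {p : ℕ} (p∈c : p ∈ᶜ c) {h : ℕ → ℕ} (hOL : IsOL (A ↾ p) K h) where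

  -- 'with' cannot be used below: Agda eta-contracts A ↾ p to A when abstracting, which
  -- makes the generated with-function ill-typed; case_of_ avoids this.
  open TypeOverImage A p h

  hOE : IsOEmb (A ↾ p) K h
  hOE = proj₁ hOL

  h-inj : ∀ t t′ → t < p → t′ < p → h t ≡ h t′ → t ≡ t′
  h-inj = IsEmb.inj (IsOEmb⇒IsEmb hOE)

  module Above (n : ℕ) (n≤κ : n ≤ᶜ κ) (h<n : ∀ t → t < p → h t < n) where
    open AddVertex K n (U A p) ρ

    θ : ℕ → ℕ
    θ = extendAt h p n

    θ-old : ∀ {t} → t < p → θ t ≡ h t
    θ-old = extendAt-< h n

    θ-new : θ p ≡ n
    θ-new = extendAt-≡ h p n

    θ-OEmb : IsOEmb (A ↾ suc p) K⁺ θ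
    θ-OEmb = record { into = into ; mono = mono ; presU = presU ; presR = presR }
      where
      into : ∀ t → t < suc p → θ t < suc n
      into t t≤p = case m<1+n⇒m<n∨m≡n t≤p of λ where
        (inj₁ t<p) → subst (_< suc n) (sym (θ-old t<p)) (m<n⇒m<1+n (h<n t t<p))
        (inj₂ refl) → subst (_< suc n) (sym θ-new) (n<1+n n)

      mono : ∀ i j → i < suc p → j < suc p → i < j → θ i < θ j
      mono i j _ j≤p i<j = case m<1+n⇒m<n∨m≡n j≤p of λ where
        (inj₁ j<p) → subst₂ _<_ (sym (θ-old (<-trans i<j j<p))) (sym (θ-old j<p))
                              (IsOEmb.mono hOE i j (<-trans i<j j<p) j<p i<j)
        (inj₂ refl) → subst₂ _<_ (sym (θ-old i<j)) (sym θ-new) (h<n i i<j)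

      presU : ∀ t → t < suc p → U⁺ (θ t) ≡ U A t
      presU t t≤p = case m<1+n⇒m<n∨m≡n t≤p of λ where
        (inj₁ t<p) → begin
          U⁺ (θ t)   ≡⟨ cong U⁺ (θ-old t<p) ⟩
          U⁺ (h t)   ≡⟨ U⁺-old (h t) (h<n t t<p) ⟩
          U K (h t)  ≡⟨ IsOEmb.presU hOE t t<p ⟩
          U A t      ∎
        (inj₂ refl) → trans (cong U⁺ θ-new) U⁺-new

      presR : ∀ i j → i < suc p → j < suc p → i ≢ j → R⁺ (θ i) (θ j) ≡ R A i j
      presR i j i≤p j≤p i≢j = case m<1+n⇒m<n∨m≡n i≤p , m<1+n⇒m<n∨m≡n j≤p of λ where
        (inj₁ i<p , inj₁ j<p) → begin
          R⁺ (θ i) (θ j)   ≡⟨ cong₂ R⁺ (θ-old i<p) (θ-old j<p) ⟩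
          R⁺ (h i) (h j)   ≡⟨ R⁺-old (h i) (h j) (h<n i i<p) (h<n j j<p) ⟩
          R K (h i) (h j)  ≡⟨ IsOEmb.presR hOE i j i<p j<p i≢j ⟩
          R A i j          ∎
        (inj₂ refl , inj₁ j<p) → begin
          R⁺ (θ p) (θ j)   ≡⟨ cong₂ R⁺ θ-new (θ-old j<p) ⟩
          R⁺ n (h j)       ≡⟨ R⁺-from-new (h j) (h<n j j<p) ⟩
          ρ (h j)          ≡⟨ ρ-image h-inj j<p ⟩
          R A p j          ∎
        (inj₁ i<p , inj₂ refl) → begin
          R⁺ (θ i) (θ p)       ≡⟨ cong₂ R⁺ (θ-old i<p) θ-new ⟩
          R⁺ (h i) n           ≡⟨ R⁺-to-new (h i) (h<n i i<p) ⟩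
          Flip L (ρ (h i))     ≡⟨ cong (Flip L) (ρ-image h-inj i<p) ⟩
          Flip L (R A p i)     ≡⟨ sym (A-isStr p i p∈c (≤-∈ᶜ-trans c (<⇒≤ i<p) p∈c) (i≢j ∘ sym)) ⟩
          R A i p              ∎
        (inj₂ refl , inj₂ refl) → contradiction refl i≢j

    ¬copyAvoidingNew : ∀ {n′} {F : Str L (fin n′)} → (n′ , F) ∈ 𝓕 → ∀ e → IsEmb F K⁺ e →
                       (∀ i → i < n′ → e i ≢ n) → ⊥
    ¬copyAvoidingNew {n′} F∈𝓕 e E avoids =
      uncurry (↾-InForb (IsFraisseLimit.age⊆ K-limit) n≤κ F∈𝓕)
              (factorThrough (SameInitial⇒idEmb {K = K} {B = K⁺} (n≤1+n n) sameInitial) E cover)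
      where
      cover : ∀ i → i < n′ → ∃[ t ] (t < n × t ≡ e i)
      cover i i<n′ = e i , ≤∧≢⇒< (m<1+n⇒m≤n (IsEmb.into E i i<n′)) (avoids i i<n′) , refl

    -- F is irreducible, so every other vertex of the copy is related to the new vertex,
    -- which forces it into the image of h; hence the copy lies in a copy of A ↾ suc p.
    ¬copyThroughNew : ∀ {n′} {F : Str L (fin n′)} → (n′ , F) ∈ 𝓕 → ∀ e → IsEmb F K⁺ e →
                      ∀ i₀ → i₀ < n′ → e i₀ ≡ n → ⊥
    ¬copyThroughNew {n′} {F} F∈𝓕 e E i₀ i₀<n′ ei₀≡n =
      uncurry (↾-InForb A-forb (∈ᶜ⇒suc≤ᶜ c p∈c) F∈𝓕)
              (factorThrough (IsOEmb⇒IsEmb θ-OEmb) E cover)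
      where
      preimage : ∀ i → i < n′ → i ≢ i₀ → ∃[ t ] (t < p × h t ≡ e i)
      preimage i i<n′ i≢i₀ = ρ≢0⇒image (e i) λ ρei≡0 →
        proj₂ (valid F∈𝓕) i₀ i i₀<n′ i<n′ (i≢i₀ ∘ sym) (begin
          R F i₀ i          ≡⟨ sym (IsEmb.presR E i₀ i i₀<n′ i<n′ (i≢i₀ ∘ sym)) ⟩
          R⁺ (e i₀) (e i)   ≡⟨ cong (λ z → R⁺ z (e i)) ei₀≡n ⟩
          R⁺ n (e i)        ≡⟨ R⁺-from-new (e i) ei<n ⟩
          ρ (e i)           ≡⟨ ρei≡0 ⟩
          fzero             ∎)
        where
        ei<n : e i < n
        ei<n = ≤∧≢⇒< (m<1+n⇒m≤n (IsEmb.into E i i<n′))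
                     (λ ei≡n → i≢i₀ (IsEmb.inj E i i₀ i<n′ i₀<n′ (trans ei≡n (sym ei₀≡n))))

      cover : ∀ i → i < n′ → ∃[ t ] (t < suc p × θ t ≡ e i)
      cover i i<n′ = case i ≟ i₀ of λ where
        (yes refl) → p , n<1+n p , trans θ-new (sym ei₀≡n)
        (no i≢i₀) → case preimage i i<n′ i≢i₀ of λ where
          (t , t<p , ht≡ei) → t , m<n⇒m<1+n t<p , trans (θ-old t<p) ht≡ei

    K⁺-InForb : InForb 𝓕 K⁺
    K⁺-InForb {n′} F∈𝓕 e E = case anyUpTo? (λ i → e i ≟ n) n′ of λ where
      (yes (i₀ , i₀<n′ , ei₀≡n)) → ¬copyThroughNew F∈𝓕 e E i₀ i₀<n′ ei₀≡n
      (no n∉image) → ¬copyAvoidingNew F∈𝓕 e E λ i i<n′ ei≡n → n∉image (i , i<n′ , ei≡n)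

    module _ (f : ℕ → ℕ) (fOE : IsOEmb K⁺ K f) (f-id : ∀ i → i < n → f i ≡ i)
             (f-gap : ∀ r → n ≤ r → r < f n → R K (f n) r ≡ fzero) where

      fθ-old : ∀ t → t < p → f (θ t) ≡ h t
      fθ-old t t<p = trans (cong f (θ-old t<p)) (f-id (h t) (h<n t t<p))

      n≤fn : n ≤ f n
      n≤fn = identityBelow⇒≤ f n f-id
               (λ i i<n → IsOEmb.mono fOE i n (m<n⇒m<1+n i<n) (n<1+n n) i<n)

      new-leftLeaning : ∀ x → x < f n → R K (f n) x ≢ fzero → ∃[ t ] (t < p × h t ≡ x)
      new-leftLeaning x x<fn Rx≢0 = case x <? n of λ where
        (no x≮n) → contradiction (f-gap x (≮⇒≥ x≮n) x<fn) Rx≢0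
        (yes x<n) → ρ≢0⇒image x λ ρx≡0 → Rx≢0 (begin
          R K (f n) x      ≡⟨ cong (R K (f n)) (sym (f-id x x<n)) ⟩
          R K (f n) (f x)  ≡⟨ IsOEmb.presR fOE n x (n<1+n n) (m<n⇒m<1+n x<n) (>⇒≢ x<n) ⟩
          R⁺ n x           ≡⟨ R⁺-from-new x x<n ⟩
          ρ x              ≡⟨ ρx≡0 ⟩
          fzero            ∎)

      h-image⇒fθ-image : ∀ {y} → ∃[ t ] (t < p × h t ≡ y) → Image (A ↾ suc p) (f ∘ θ) y
      h-image⇒fθ-image (t , t<p , ht≡y) = t , m<n⇒m<1+n t<p , trans (fθ-old t t<p) ht≡y

      fθ-leftLeaning : LeftLeaning K (Image (A ↾ suc p) (f ∘ θ))
      fθ-leftLeaning .(f (θ i)) x (i , i≤p , refl) x<a Rax≢0 = case m<1+n⇒m<n∨m≡n i≤p of λ where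
        (inj₁ i<p) → h-image⇒fθ-image
                       (proj₂ hOL (f (θ i)) x (i , i<p , sym (fθ-old i i<p)) x<a Rax≢0)
        (inj₂ refl) → h-image⇒fθ-image (new-leftLeaning x
                        (subst (λ z → x < f z) θ-new x<a)
                        (subst (λ z → R K (f z) x ≢ fzero) θ-new Rax≢0))

    extendAbove : ∃[ h′ ] (IsOL (A ↾ suc p) K h′ × (∀ t → t < p → h′ t ≡ h t) × n ≤ h′ p)
    extendAbove =
      case K-leftDense n K⁺ (isStr n≤κ (IsFraisseLimit.isStr K-limit)) K⁺-InForb n≤κ sameInitial
      of λ where
        (f , fOE , f-id , f-gap) →
          f ∘ θ , (IsOEmb-∘ fOE θ-OEmb , fθ-leftLeaning f fOE f-id f-gap) ,
          fθ-old f fOE f-id f-gap ,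
          subst (λ z → n ≤ f z) (sym θ-new) (n≤fn f fOE f-id f-gap)

  -- A finite K would have to contain a point f(|K|) ≥ |K|.
  κ≡ω : κ ≡ ω
  κ≡ω = κ-infinite κ refl
    where
    κ-infinite : ∀ κ′ → κ ≡ κ′ → κ ≡ ω
    κ-infinite ω κ≡ω = κ≡ω
    κ-infinite (fin n) κ≡n =
      case Above.extendAbove n (subst (n ≤ᶜ_) (sym κ≡n) ≤-refl)
                               (λ t t<p → subst (h t ∈ᶜ_) κ≡n (IsOEmb.into hOE t t<p)) of λ where
        (h′ , (h′OE , _) , _ , n≤h′p) →
          contradiction n≤h′p (<⇒≱ (subst (h′ p ∈ᶜ_) κ≡n (IsOEmb.into h′OE p (n<1+n p))))

  extendOL : (N : ℕ) → ∃[ h′ ] (IsOL (A ↾ suc p) K h′ × (∀ t → t < p → h′ t ≡ h t) × N ≤ h′ p)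
  extendOL N = case upperBound h p of λ where
    (b , h<b) →
      case Above.extendAbove (N ⊔ b) (subst ((N ⊔ b) ≤ᶜ_) (sym κ≡ω) tt)
                             (λ t t<p → <-≤-trans (h<b t t<p) (m≤n⊔m N b)) of λ where
        (h′ , h′OL , h′-extends , N⊔b≤h′p) →
          h′ , h′OL , h′-extends , ≤-trans (m≤m⊔n N b) N⊔b≤h′p

module _ {L : Lang} {κ c} {A : Str L c} {K : Str L κ} where

  limit-IsOL : ∀ {m} (H : ℕ → ℕ → ℕ) (H-stable : ∀ s i → i < s + m → H (suc s) i ≡ H s i) →
               (∀ s → IsOL (A ↾ ((s + m) ⊓ᶜ c)) K (H s)) →
               IsOL A K (Stabilising.limit m H H-stable)
  limit-IsOL {m} H H-stable H-OL =
    record { into = into ; mono = mono ; presU = presU ; presR = presR } , leftLeaning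
    where
    open Stabilising m H H-stable

    OE : ∀ s → IsOEmb (A ↾ ((s + m) ⊓ᶜ c)) K (H s)
    OE s = proj₁ (H-OL s)

    ≤⇒<suc+m : ∀ {i s} → i ≤ s → i < suc s + m
    ≤⇒<suc+m {s = s} i≤s = s≤s (≤-trans i≤s (m≤m+n s m))

    inDomain : ∀ {i s} → i ≤ s → i ∈ᶜ c → i < (suc s + m) ⊓ᶜ c
    inDomain i≤s i∈c = <-⊓ᶜ c (≤⇒<suc+m i≤s) i∈c

    agrees : ∀ {i s} → i ≤ s → limit i ≡ H (suc s) i
    agrees i≤s = limit-agrees (≤⇒<suc+m i≤s)

    into : ∀ i → i ∈ᶜ c → limit i ∈ᶜ κ
    into i i∈c = IsOEmb.into (OE (suc i)) i (inDomain ≤-refl i∈c)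

    mono : ∀ i j → i ∈ᶜ c → j ∈ᶜ c → i < j → limit i < limit j
    mono i j i∈c j∈c i<j = subst (_< limit j) (sym (agrees (<⇒≤ i<j)))
      (IsOEmb.mono (OE (suc j)) i j (inDomain (<⇒≤ i<j) i∈c) (inDomain ≤-refl j∈c) i<j)

    presU : ∀ i → i ∈ᶜ c → U K (limit i) ≡ U A i
    presU i i∈c = IsOEmb.presU (OE (suc i)) i (inDomain ≤-refl i∈c)

    presR : ∀ i j → i ∈ᶜ c → j ∈ᶜ c → i ≢ j → R K (limit i) (limit j) ≡ R A i j
    presR i j i∈c j∈c i≢j =
      trans (cong₂ (R K) (agrees (m≤m⊔n i j)) (agrees (m≤n⊔m i j)))
            (IsOEmb.presR (OE (suc (i ⊔ j))) i j
              (inDomain (m≤m⊔n i j) i∈c) (inDomain (m≤n⊔m i j) j∈c) i≢j)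

    leftLeaning : LeftLeaning K (Image A limit)
    leftLeaning .(limit i) x (i , i∈c , refl) x<a Rax≢0 =
      case proj₂ (H-OL (suc i)) (limit i) x (i , inDomain ≤-refl i∈c , refl) x<a Rax≢0 of λ where
        (t , t<dom , Ht≡x) →
          t , <⊓ᶜ⇒∈ᶜ _ c t<dom , trans (limit-agrees (<⊓ᶜ⇒< (suc i + m) c t<dom)) Ht≡x

module Extension {L : Lang} {𝓕 : List (FinStr L)} (valid : ValidForb 𝓕)
  {κ} (K : Str L κ) (K-limit : IsFraisseLimit 𝓕 K) (K-leftDense : LeftDense 𝓕 K)
  {c} (A : Str L c) (A-isStr : IsStr A) (A-forb : FinSubsInForb 𝓕 A)
  (N : ℕ) {m : ℕ} (m≤c : m ≤ᶜ c) {g : ℕ → ℕ} (gOL : IsOL (A ↾ m) K g) where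

  ↾-subst : ∀ {k k′ h} → k ≡ k′ → IsOL (A ↾ k) K h → IsOL (A ↾ k′) K h
  ↾-subst {h = h} = subst (λ k → IsOL (A ↾ k) K h)

  IsOLBelow : ℕ → (ℕ → ℕ) → Set
  IsOLBelow q h = IsOL (A ↾ (q ⊓ᶜ c)) K h

  step : ∀ q h → IsOLBelow q h →
         ∃[ h′ ] (IsOLBelow (suc q) h′ × (∀ i → i < q → h′ i ≡ h i) × (q ∈ᶜ c → N ≤ h′ q))
  step q h hOL = case q ∈ᶜ? c of λ where
    (no q∉c) →
      h , ↾-subst (sym (∉ᶜ⇒suc-⊓ᶜ≡ c q∉c)) hOL , (λ _ _ → refl) , (λ q∈c → contradiction q∈c q∉c)
    (yes q∈c) →
      case OneStep.extendOL valid K K-limit K-leftDense A A-isStr A-forb q∈c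
             (↾-subst (≤ᶜ⇒⊓ᶜ≡ c (∈ᶜ⇒≤ᶜ c q∈c)) hOL) N of λ where
        (h′ , h′OL , h′-extends , N≤h′q) →
          h′ , ↾-subst (sym (≤ᶜ⇒⊓ᶜ≡ c (∈ᶜ⇒suc≤ᶜ c q∈c))) h′OL , h′-extends , λ _ → N≤h′q

  chain : ∀ s → Σ (ℕ → ℕ) (IsOLBelow (s + m))
  chain zero = g , ↾-subst (sym (≤ᶜ⇒⊓ᶜ≡ c m≤c)) gOL
  chain (suc s) = map₂ proj₁ (step (s + m) (proj₁ (chain s)) (proj₂ (chain s)))

  H : ℕ → ℕ → ℕ
  H s = proj₁ (chain s)

  H-stable : ∀ s i → i < s + m → H (suc s) i ≡ H s i
  H-stable s = proj₁ (proj₂ (proj₂ (step (s + m) (H s) (proj₂ (chain s)))))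

  open Stabilising m H H-stable public using (limit; limit-agrees)

  limit-OL : IsOL A K limit
  limit-OL = limit-IsOL H H-stable (proj₂ ∘ chain)

  limit-extends : ∀ i → i < m → limit i ≡ g i
  limit-extends i = limit-agrees {s = 0}

  limit-above : m ∈ᶜ c → N ≤ limit m
  limit-above m∈c = subst (N ≤_) (sym (limit-agrees {s = 1} (n<1+n m)))
                      (proj₂ (proj₂ (proj₂ (step m g (proj₂ (chain 0))))) m∈c)

lemma3p1 : (L : Lang) (𝓕 : List (FinStr L)) → ValidForb 𝓕 →
    {κ : Card} (K : Str L κ) → IsFraisseLimit 𝓕 K → LeftDense 𝓕 K →
    {c : Card} (A : Str L c) → IsStr A → FinSubsInForb 𝓕 A →
    (m : ℕ) → m ≤ᶜ c → (g : ℕ → ℕ) → IsOL (A ↾ m) K g →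
    (∃[ f ] (IsOL A K f × (∀ i → i < m → f i ≡ g i)))
    × (m ∈ᶜ c → (N : ℕ) →
        ∃[ f ] (IsOL A K f × (∀ i → i < m → f i ≡ g i) × N ≤ f m))
lemma3p1 L 𝓕 valid K K-limit K-leftDense A A-isStr A-forb m m≤c g gOL =
  (E.limit 0 , E.limit-OL 0 , E.limit-extends 0) ,
  λ m∈c N → E.limit N , E.limit-OL N , E.limit-extends N , E.limit-above N m∈c
  where
  module E (N : ℕ) = Extension valid K K-limit K-leftDense A A-isStr A-forb N m≤c gOL
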